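{- Let $\mathbf A\in\mathbf G_{\mathsf{FL}_{\mathsf e}}(\mathsf{BA})$ and let $\delta\colon A\to A$ be an increasing map (i.e. $x\leq\delta(x)$ for all $x$). Define $x{\Rightarrow}_\delta y:=(x\to y)\wedge(y\to\delta(x))$. If $1\leq (x{\Rightarrow}_\delta y){\Rightarrow}_\delta\neg(x{\Rightarrow}_\delta\neg y)$ for all $x,y\in A$, then $\delta(x)=\neg\neg x$ for all $x\in A$.
   Context: An FL${}_{\mathrm e}$-algebra is an algebra $\langle A,\wedge,\vee,\cdot,\to,0,1\rangle$ such that $\langle A,\wedge,\vee\rangle$ is a lattice (with order $\leq$), $\langle A,\cdot,1\rangle$ is a commutative monoid, $0$ is an arbitrary constant, and $x\cdot y\leq z\iff x\leq y\to z$. Write $\neg x:=x\to 0$. $\mathsf{BA}$ is the variety of Boolean algebras viewed as FL${}_{\mathrm e}$-algebras satisfying $x\cdot y=x\wedge y$ and $x\to y=\neg x\vee y$; $\mathbf G_{\mathsf{FL}_{\mathsf e}}(\mathsf{BA})$ is the largest variety $\mathsf W$ of FL${}_{\mathrm e}$-algebras such that for every equation $s\approx t$, $\mathsf{BA}\models s\approx t$ iff $\mathsf W\models\neg s\approx\neg t$. -}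

module Defs where

open import Level using (Level; suc; _⊔_; 0ℓ)
open import Data.Nat using (ℕ)
open import Data.Product using (Σ; _×_)
open import Function.Bundles using (_⇔_)
open import Relation.Binary.PropositionalEquality using (_≡_)
open import Algebra.Structures using (IsCommutativeMonoid)
open import Algebra.Lattice.Structures using (IsLattice)

record FLe (c : Level) : Set (suc c) where
  infixr 6 _∨_
  infixr 7 _∧_
  infixr 7 _·_
  infixr 5 _↝_
  field
    Carrier : Set c
    _∧_ _∨_ _·_ _↝_ : Carrier → Carrier → Carrier
    𝟘 𝟙 : Carrier
    isLattice : IsLattice _≡_ _∨_ _∧_
    isCommutativeMonoid : IsCommutativeMonoid _≡_ _·_ 𝟙

  _≤_ : Carrier → Carrier → Set c
  x ≤ y = x ∧ y ≡ x

  field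
    residuation : ∀ x y z → ((x · y) ≤ z) ⇔ (x ≤ (y ↝ z))

  ¬_ : Carrier → Carrier
  ¬ x = x ↝ 𝟘

IsBoolean : ∀ {c} → FLe c → Set c
IsBoolean A = (∀ x y → x · y ≡ x ∧ y) × (∀ x y → (x ↝ y) ≡ (¬ x) ∨ y) × (∀ x → 𝟘 ≤ x)
  where open FLe A

data Term : Set where
  var : ℕ → Term
  _∧ₜ_ _∨ₜ_ _·ₜ_ _↝ₜ_ : Term → Term → Term
  0ₜ 1ₜ : Term

¬ₜ_ : Term → Term
¬ₜ t = t ↝ₜ 0ₜ

eval : ∀ {c} (A : FLe c) → Term → (ℕ → FLe.Carrier A) → FLe.Carrier A
eval A (var i) ρ = ρ i
eval A (s ∧ₜ t) ρ = FLe._∧_ A (eval A s ρ) (eval A t ρ)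
eval A (s ∨ₜ t) ρ = FLe._∨_ A (eval A s ρ) (eval A t ρ)
eval A (s ·ₜ t) ρ = FLe._·_ A (eval A s ρ) (eval A t ρ)
eval A (s ↝ₜ t) ρ = FLe._↝_ A (eval A s ρ) (eval A t ρ)
eval A 0ₜ ρ = FLe.𝟘 A
eval A 1ₜ ρ = FLe.𝟙 A

_⊨_≈_ : ∀ {c} → FLe c → Term → Term → Set c
A ⊨ s ≈ t = ∀ (ρ : ℕ → FLe.Carrier A) → eval A s ρ ≡ eval A t ρ

BA⊨ : (c : Level) → Term → Term → Set (suc c)
BA⊨ c s t = ∀ (B : FLe c) → IsBoolean B → B ⊨ s ≈ t

Equations : Set₁
Equations = Term → Term → Set

Models : ∀ {c} → Equations → FLe c → Set c
Models E A = ∀ s t → E s t → A ⊨ s ≈ t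

Var⊨ : (c : Level) → Equations → Term → Term → Set (suc c)
Var⊨ c E s t = ∀ (B : FLe c) → Models E B → B ⊨ s ≈ t

GProperty : (c : Level) → Equations → Set (suc c)
GProperty c E = ∀ s t → BA⊨ c s t ⇔ Var⊨ c E (¬ₜ s) (¬ₜ t)

-- A ∈ G_FLe(BA): A lies in some variety with the defining property.
-- Since G_FLe(BA) is the largest such variety, this is exactly membership.
InG : ∀ {c} → FLe c → Set (suc c)
InG {c} A = Σ Equations (λ E → Models E A × GProperty c E)

⇒[_] : ∀ {c} (A : FLe c) → (FLe.Carrier A → FLe.Carrier A) → FLe.Carrier A → FLe.Carrier A → FLe.Carrier A
⇒[ A ] δ x y = (x ↝ y) ∧ (y ↝ δ x)
  where open FLe A

{-# OPTIONS --safe #-}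
module Submission where

open import Defs
open import Data.Nat using (zero; suc)
open import Data.Product using (_×_; _,_; proj₁; proj₂)
open import Function.Bundles using (Equivalence)
open import Relation.Binary.PropositionalEquality
  using (_≡_; refl; sym; trans; cong; cong₂; subst; subst₂)
open import Algebra.Structures using (IsCommutativeMonoid)
open import Algebra.Lattice.Bundles using (Lattice)
import Algebra.Lattice.Properties.Lattice as LatticeProperties
open import Relation.Binary.Lattice using (MeetSemilattice)

-- Membership in G(BA) means that every Boolean equation s ≈ t holds in A
-- as ¬s ≈ ¬t. From x·0 ≈ 0 we learn that ¬0 is the top element, and from
-- the Boolean inequality ¬x·y ≤ (x → ¬y) ∧ (¬y → y) that
-- (x → ¬y) ∧ (¬y → y) ≤ 0 implies y ≤ ¬¬x. Since 1 ≤ x ⇒δ δx, the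
-- hypothesis at (x, δx) gives x ⇒δ ¬δx ≤ 0, hence δx ≤ ¬¬x. The hypothesis
-- at (1, 1) shows ¬0 ≤ δ1, so 1 ⇒δ u = u for all u, and then the hypothesis
-- at (1, x) reads ¬¬x ≤ δx.

module FLeProperties {c} (A : FLe c) where
  open FLe A
  open IsCommutativeMonoid isCommutativeMonoid using (comm; identityˡ; identityʳ)

  private
    lattice : Lattice c c
    lattice = record { isLattice = isLattice }

    -- The library's natural order is x ≡ x ∧ y, the converse equation.
    module M = MeetSemilattice (LatticeProperties.∧-orderTheoreticMeetSemilattice lattice)

  ≤-refl : ∀ {x} → x ≤ x
  ≤-refl = sym M.refl

  ≤-reflexive : ∀ {x y} → x ≡ y → x ≤ y
  ≤-reflexive refl = ≤-refl

  ≤-trans : ∀ {x y z} → x ≤ y → y ≤ z → x ≤ z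
  ≤-trans p q = sym (M.trans (sym p) (sym q))

  ≤-antisym : ∀ {x y} → x ≤ y → y ≤ x → x ≡ y
  ≤-antisym p q = M.antisym (sym p) (sym q)

  x∧y≤x : ∀ x y → (x ∧ y) ≤ x
  x∧y≤x x y = sym (M.x∧y≤x x y)

  x∧y≤y : ∀ x y → (x ∧ y) ≤ y
  x∧y≤y x y = sym (M.x∧y≤y x y)

  ∧-greatest : ∀ {x y z} → x ≤ y → x ≤ z → x ≤ (y ∧ z)
  ∧-greatest p q = sym (M.∧-greatest (sym p) (sym q))

  ·≤⇒≤↝ : ∀ {x y z} → (x · y) ≤ z → x ≤ (y ↝ z)
  ·≤⇒≤↝ {x} {y} {z} = Equivalence.to (residuation x y z)

  ≤↝⇒·≤ : ∀ {x y z} → x ≤ (y ↝ z) → (x · y) ≤ z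
  ≤↝⇒·≤ {x} {y} {z} = Equivalence.from (residuation x y z)

  ·-monoʳ-≤ : ∀ z {x y} → x ≤ y → (z · x) ≤ (z · y)
  ·-monoʳ-≤ z {x} {y} x≤y =
    subst (_≤ (z · y)) (comm x z) (≤↝⇒·≤ (≤-trans x≤y (·≤⇒≤↝ (≤-reflexive (comm y z)))))

  ≤⇒𝟙≤↝ : ∀ {x y} → x ≤ y → 𝟙 ≤ (x ↝ y)
  ≤⇒𝟙≤↝ {x} x≤y = ·≤⇒≤↝ (subst (_≤ _) (sym (identityˡ x)) x≤y)

  𝟙≤↝⇒≤ : ∀ {x y} → 𝟙 ≤ (x ↝ y) → x ≤ y
  𝟙≤↝⇒≤ {x} 𝟙≤x↝y = subst (_≤ _) (identityˡ x) (≤↝⇒·≤ 𝟙≤x↝y)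

  𝟙↝x≡x : ∀ x → (𝟙 ↝ x) ≡ x
  𝟙↝x≡x x = ≤-antisym
    (subst (_≤ x) (identityʳ (𝟙 ↝ x)) (≤↝⇒·≤ ≤-refl))
    (·≤⇒≤↝ (≤-reflexive (identityʳ x)))

  ¬x·x≤𝟘 : ∀ x → (¬ x · x) ≤ 𝟘
  ¬x·x≤𝟘 x = ≤↝⇒·≤ ≤-refl

  ¬-antimono-≤ : ∀ {x y} → x ≤ y → (¬ y) ≤ (¬ x)
  ¬-antimono-≤ {y = y} x≤y = ·≤⇒≤↝ (≤-trans (·-monoʳ-≤ (¬ y) x≤y) (¬x·x≤𝟘 y))

  module _ (δ : Carrier → Carrier) where

    𝟙≤⇒-intro : ∀ {x y} → x ≤ y → y ≤ δ x → 𝟙 ≤ ⇒[ A ] δ x y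
    𝟙≤⇒-intro x≤y y≤δx = ∧-greatest (≤⇒𝟙≤↝ x≤y) (≤⇒𝟙≤↝ y≤δx)

    𝟙≤⇒-elim : ∀ {x y} → 𝟙 ≤ ⇒[ A ] δ x y → (x ≤ y) × (y ≤ δ x)
    𝟙≤⇒-elim 𝟙≤x⇒y =
      𝟙≤↝⇒≤ (≤-trans 𝟙≤x⇒y (x∧y≤x _ _)) , 𝟙≤↝⇒≤ (≤-trans 𝟙≤x⇒y (x∧y≤y _ _))

    𝟙⇒𝟙≡𝟙 : 𝟙 ≤ δ 𝟙 → ⇒[ A ] δ 𝟙 𝟙 ≡ 𝟙
    𝟙⇒𝟙≡𝟙 𝟙≤δ𝟙 = trans (cong₂ _∧_ (𝟙↝x≡x 𝟙) (𝟙↝x≡x (δ 𝟙))) 𝟙≤δ𝟙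

    𝟙⇒¬𝟙≤𝟘 : (⇒[ A ] δ 𝟙 (¬ 𝟙)) ≤ 𝟘
    𝟙⇒¬𝟙≤𝟘 = ≤-trans (x∧y≤x _ _) (≤-reflexive (trans (𝟙↝x≡x (¬ 𝟙)) (𝟙↝x≡x 𝟘)))

    𝟙⇒x≡x : (∀ x → x ≤ δ 𝟙) → ∀ x → ⇒[ A ] δ 𝟙 x ≡ x
    𝟙⇒x≡x δ𝟙-greatest x =
      trans (cong (_∧ (x ↝ δ 𝟙)) (𝟙↝x≡x x)) (·≤⇒≤↝ (δ𝟙-greatest (x · x)))

module BooleanProperties {c} (B : FLe c) (isBoolean : IsBoolean B) where
  open FLe B
  open FLeProperties B
  open IsCommutativeMonoid isCommutativeMonoid using (assoc; comm)

  private
    ·≡∧ : ∀ x y → x · y ≡ x ∧ y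
    ·≡∧ = proj₁ isBoolean

    𝟘-least : ∀ x → 𝟘 ≤ x
    𝟘-least = proj₂ (proj₂ isBoolean)

  x·𝟘≡𝟘 : ∀ x → (x · 𝟘) ≡ 𝟘
  x·𝟘≡𝟘 x = ≤-antisym (subst (_≤ 𝟘) (sym (·≡∧ x 𝟘)) (x∧y≤y x 𝟘)) (𝟘-least (x · 𝟘))

  ¬x·y≤x↝¬y : ∀ x y → (¬ x · y) ≤ (x ↝ ¬ y)
  ¬x·y≤x↝¬y x y = ·≤⇒≤↝ (≤-trans (≤-reflexive rearrange) y·𝟘≤¬y)
    where
      rearrange : (¬ x · y) · x ≡ y · (¬ x · x)
      rearrange = trans (assoc (¬ x) y x) (trans (cong (¬ x ·_) (comm y x))
                    (trans (sym (assoc (¬ x) x y)) (comm (¬ x · x) y)))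

      y·𝟘≤¬y : (y · (¬ x · x)) ≤ (¬ y)
      y·𝟘≤¬y = ≤-trans (·-monoʳ-≤ y (¬x·x≤𝟘 x))
        (subst (_≤ (¬ y)) (sym (x·𝟘≡𝟘 y)) (𝟘-least (¬ y)))

  ¬x·y≤¬y↝y : ∀ x y → (¬ x · y) ≤ (¬ y ↝ y)
  ¬x·y≤¬y↝y x y = ·≤⇒≤↝ (subst (_≤ y) (sym ¬x·y·¬y≡¬x∧y∧¬y)
                     (≤-trans (x∧y≤x (¬ x ∧ y) (¬ y)) (x∧y≤y (¬ x) y)))
    where
      ¬x·y·¬y≡¬x∧y∧¬y : (¬ x · y) · ¬ y ≡ (¬ x ∧ y) ∧ ¬ y
      ¬x·y·¬y≡¬x∧y∧¬y = trans (·≡∧ (¬ x · y) (¬ y)) (cong (_∧ ¬ y) (·≡∧ (¬ x) y))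

module GlivenkoProperties {c} (A : FLe c) (inG : InG A) where
  open FLe A
  open FLeProperties A

  InG⇒⊨¬≈¬ : ∀ {s t} → BA⊨ c s t → A ⊨ (¬ₜ s) ≈ (¬ₜ t)
  InG⇒⊨¬≈¬ {s} {t} BA⊨s≈t =
    let _ , A⊨E , G = inG in Equivalence.to (G s t) BA⊨s≈t A A⊨E

  ¬𝟘-greatest : ∀ x → x ≤ (¬ 𝟘)
  ¬𝟘-greatest x = ·≤⇒≤↝ (𝟙≤↝⇒≤ (subst (𝟙 ≤_) (sym ¬[x·𝟘]≡¬𝟘) (≤⇒𝟙≤↝ ≤-refl)))
    where
      ¬[x·𝟘]≡¬𝟘 : ¬ (x · 𝟘) ≡ ¬ 𝟘
      ¬[x·𝟘]≡¬𝟘 = InG⇒⊨¬≈¬ {var 0 ·ₜ 0ₜ} {0ₜ}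
        (λ B isBoolean ρ → BooleanProperties.x·𝟘≡𝟘 B isBoolean (ρ 0)) (λ _ → x)

  ⇒¬≤𝟘⇒≤¬¬ : ∀ x y → ((x ↝ ¬ y) ∧ (¬ y ↝ y)) ≤ 𝟘 → y ≤ (¬ ¬ x)
  ⇒¬≤𝟘⇒≤¬¬ x y x⇒¬y≤𝟘 = ·≤⇒≤↝ (subst (_≤ 𝟘) (comm (¬ x) y) w≤𝟘)
    where
      open IsCommutativeMonoid isCommutativeMonoid using (comm)

      w b : Carrier
      w = ¬ x · y
      b = (x ↝ ¬ y) ∧ (¬ y ↝ y)

      ¬[w∧b]≡¬w : (¬ (w ∧ b)) ≡ (¬ w)
      ¬[w∧b]≡¬w = InG⇒⊨¬≈¬ {wₜ ∧ₜ ((var 0 ↝ₜ (¬ₜ var 1)) ∧ₜ ((¬ₜ var 1) ↝ₜ var 1))} {wₜ}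
        (λ B isBoolean ρ → let open BooleanProperties B isBoolean in
          FLeProperties.∧-greatest B (¬x·y≤x↝¬y (ρ 0) (ρ 1)) (¬x·y≤¬y↝y (ρ 0) (ρ 1)))
        (λ { zero → x ; (suc _) → y })
        where
          wₜ = (¬ₜ var 0) ·ₜ var 1

      w≤𝟘 : w ≤ 𝟘
      w≤𝟘 = 𝟙≤↝⇒≤ (subst (𝟙 ≤_) ¬[w∧b]≡¬w (≤⇒𝟙≤↝ (≤-trans (x∧y≤y w b) x⇒¬y≤𝟘)))

proposition4p4 : ∀ {c} (A : FLe c) → InG A →
    (δ : FLe.Carrier A → FLe.Carrier A) →
    (∀ x → FLe._≤_ A x (δ x)) →
    (∀ x y → FLe._≤_ A (FLe.𝟙 A) (⇒[ A ] δ (⇒[ A ] δ x y) (FLe.¬_ A (⇒[ A ] δ x (FLe.¬_ A y))))) →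
    ∀ x → δ x ≡ FLe.¬_ A (FLe.¬_ A x)
proposition4p4 A inG δ δ-increasing H x = ≤-antisym (δ≤¬¬ x) (¬¬≤δ x)
  where
    open FLe A
    open FLeProperties A
    open GlivenkoProperties A inG

    δ≤¬¬ : ∀ z → δ z ≤ (¬ ¬ z)
    δ≤¬¬ z = ⇒¬≤𝟘⇒≤¬¬ z (δ z) (𝟙≤↝⇒≤ (≤-trans 𝟙≤z⇒δz (proj₁ (𝟙≤⇒-elim δ (H z (δ z))))))
      where
        𝟙≤z⇒δz : 𝟙 ≤ ⇒[ A ] δ z (δ z)
        𝟙≤z⇒δz = 𝟙≤⇒-intro δ (δ-increasing z) ≤-refl

    ¬𝟘≤δ𝟙 : (¬ 𝟘) ≤ δ 𝟙
    ¬𝟘≤δ𝟙 = ≤-trans (¬-antimono-≤ (𝟙⇒¬𝟙≤𝟘 δ))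
      (subst (λ u → (¬ (⇒[ A ] δ 𝟙 (¬ 𝟙))) ≤ δ u) (𝟙⇒𝟙≡𝟙 δ (δ-increasing 𝟙))
        (proj₂ (𝟙≤⇒-elim δ (H 𝟙 𝟙))))

    ¬¬≤δ : ∀ z → (¬ ¬ z) ≤ δ z
    ¬¬≤δ z = subst₂ (λ u v → (¬ u) ≤ δ v) (𝟙⇒≡id (¬ z)) (𝟙⇒≡id z)
      (proj₂ (𝟙≤⇒-elim δ (H 𝟙 z)))
      where
        𝟙⇒≡id : ∀ u → ⇒[ A ] δ 𝟙 u ≡ u
        𝟙⇒≡id = 𝟙⇒x≡x δ (λ u → ≤-trans (¬𝟘-greatest u) ¬𝟘≤δ𝟙)
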